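{- For any odd cactus $G$ and any black white partition $(V_B,V_W,E_B,E_W)$ of $G$, $|E_B|\le src(G)$.
   Context: All graphs are finite, simple, connected and non-empty. A cactus is a graph in which every edge lies in at most one cycle; an odd cactus is a cactus with no even cycle. $src(G)$ is the minimum $k$ such that there is a map $c:E(G)\to\{1,\dots,k\}$ with every pair of vertices $u,v$ joined by a shortest $u,v$ path whose edges have pairwise distinct colors. Antipodes: for an odd cycle $C$ and edge $v_2v_3\in E(C)$, the unique $v_1\in V(C)$ with $d(v_1,v_2)=d(v_1,v_3)$ is denoted $\mathrm{opp}(v_2v_3)$. Black white partition: $(V_B,V_W,E_B,E_W)$ where $(V_B,V_W)$ partitions $V(G)$ and $(E_B,E_W)$ partitions $E(G)$ such that: (1) for any cycle $C$ of $G$ and $e\in E(C)$, $e\in E_B$ iff $\mathrm{opp}(e)\in V_W$, and $e\in E_W$ iff $\mathrm{opp}(e)\in V_B$; (2) if $v_1v_2\in E_B$ then $\{v_1,v_2\}\subseteq V_B$; (3) if $v\in V_W$ then every edge $uv\in E(G)$ lies in $E_W$; (4) for every cut vertex $v\in V_W$ there is a component $K$ of $G-v$ with $E_B\subseteq E(K)$. -}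

module Defs where

open import Data.Nat using (ℕ; zero; suc; _+_; _≤_; _%_; _<ᵇ_)
open import Data.Fin using (Fin; toℕ)
open import Data.Bool using (Bool; true; false; T; _∧_; not; if_then_else_)
open import Data.List using (List; []; _∷_; _++_; length; map; concatMap)
open import Data.Nat.ListAction using (sum)
open import Data.List.Membership.Propositional using (_∈_; _∉_)
open import Data.List.Relation.Unary.Unique.Propositional using (Unique)
open import Data.Product using (Σ; ∃; _×_; _,_)
open import Data.Sum using (_⊎_)
open import Relation.Binary.PropositionalEquality using (_≡_; _≢_)
open import Relation.Nullary using (¬_)
open import Data.List.Base using (allFin)

record Graph : Set where
  field
    n      : ℕ
    adj    : Fin n → Fin n → Bool
    sym    : ∀ u v → T (adj u v) → T (adj v u)
    irrefl : ∀ u → ¬ T (adj u u)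

module _ (G : Graph) where
  open Graph G

  V : Set
  V = Fin n

  data Walk : V → V → List V → Set where
    wnil  : ∀ {u} → Walk u u (u ∷ [])
    wcons : ∀ {u w v p} → T (adj u w) → Walk w v p → Walk u v (u ∷ p)

  IsPath : V → V → List V → Set
  IsPath u v p = Walk u v p × Unique p

  -- A shortest u,v path: a path no longer than any u,v walk.
  -- (length counts vertices, i.e. number of edges + 1.)
  IsShortestPath : V → V → List V → Set
  IsShortestPath u v p = IsPath u v p × (∀ q → Walk u v q → length p ≤ length q)

  Dist : V → V → ℕ → Set
  Dist u v m = Σ (List V) λ p → IsShortestPath u v p × length p ≡ suc m

  NonEmpty : Set
  NonEmpty = Σ ℕ λ m → n ≡ suc m

  Connected : Set
  Connected = ∀ u v → Σ (List V) λ p → Walk u v p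

  record Cycle : Set where
    field
      first last : V
      verts      : List V
      walk       : Walk first last verts
      uniq       : Unique verts
      long       : 3 ≤ length verts
      close      : T (adj last first)

  VertOf : Cycle → V → Set
  VertOf C x = x ∈ Cycle.verts C

  EdgeOf : Cycle → V → V → Set
  EdgeOf C x y =
      (Σ (List V) λ as → Σ (List V) λ bs → Cycle.verts C ≡ as ++ x ∷ y ∷ bs)
    ⊎ (Σ (List V) λ as → Σ (List V) λ bs → Cycle.verts C ≡ as ++ y ∷ x ∷ bs)
    ⊎ (x ≡ Cycle.last C × y ≡ Cycle.first C)
    ⊎ (y ≡ Cycle.last C × x ≡ Cycle.first C)

  -- Every edge lies in at most one cycle (cycles identified with their
  -- edge sets).
  Cactus : Set
  Cactus = ∀ (C D : Cycle) x y → EdgeOf C x y → EdgeOf D x y →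
           ∀ a b → (EdgeOf C a b → EdgeOf D a b) × (EdgeOf D a b → EdgeOf C a b)

  OddCactus : Set
  OddCactus = Cactus × (∀ (C : Cycle) → length (Cycle.verts C) % 2 ≡ 1)

  record Colouring (k : ℕ) : Set where
    field
      col     : (u v : V) → T (adj u v) → Fin k
      col-sym : ∀ u v (e : T (adj u v)) → col u v e ≡ col v u (sym u v e)

  walkColours : ∀ {k} → Colouring k → ∀ {u v p} → Walk u v p → List (Fin k)
  walkColours c wnil = []
  walkColours c (wcons {u} {w} e w′) = Colouring.col c u w e ∷ walkColours c w′

  StrongRainbow : ∀ {k} → Colouring k → Set
  StrongRainbow c = ∀ u v → Σ (List V) λ p → Σ (Walk u v p) λ w →
                      IsShortestPath u v p × Unique (walkColours c w)

  HasSRC : ℕ → Set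
  HasSRC k = Σ (Colouring k) StrongRainbow

  IsSRC : ℕ → Set
  IsSRC k = HasSRC k × (∀ k′ → HasSRC k′ → k ≤ k′)

  ReachAvoid : V → V → V → Set
  ReachAvoid v w x = Σ (List V) λ p → Walk w x p × v ∉ p

  CutVertex : V → Set
  CutVertex v = Σ V λ a → Σ V λ b → a ≢ v × b ≢ v × ¬ ReachAvoid v a b

  -- Black white partitions.  V_B = {v | black v ≡ true},
  -- V_W = {v | black v ≡ false}, E_B = {uv ∈ E | eb u v ≡ true},
  -- E_W = {uv ∈ E | eb u v ≡ false}.

  record BWPartition : Set where
    field
      black  : V → Bool
      eb     : V → V → Bool
      eb-sym : ∀ u v → T (adj u v) → eb u v ≡ eb v u
      -- (1) e ∈ E_B iff opp(e) ∈ V_W (equivalently e ∈ E_W iff opp(e) ∈ V_B)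
      cond1  : ∀ (C : Cycle) v₂ v₃ → EdgeOf C v₂ v₃ →
               ∀ v₁ → VertOf C v₁ → ∀ m → Dist v₁ v₂ m → Dist v₁ v₃ m →
               eb v₂ v₃ ≡ not (black v₁)
      cond2  : ∀ v₁ v₂ → T (adj v₁ v₂) → T (eb v₁ v₂) →
               black v₁ ≡ true × black v₂ ≡ true
      cond3  : ∀ u v → black v ≡ false → T (adj u v) → eb u v ≡ false
      cond4  : ∀ v → black v ≡ false → CutVertex v →
               Σ V λ w → w ≢ v × (∀ x y → T (adj x y) → T (eb x y) →
                                     ReachAvoid v w x × ReachAvoid v w y)

  countEB : BWPartition → ℕ
  countEB P = sum (map (λ uv → if ind uv then 1 else 0) pairs)
    where
      pairs : List (V × V)
      pairs = concatMap (λ u → map (λ v → (u , v)) (allFin n)) (allFin n)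
      ind : V × V → Bool
      ind (u , v) = (toℕ u <ᵇ toℕ v) ∧ adj u v ∧ BWPartition.eb P u v

-- Fix a strong rainbow colouring of G with k colours.  We show that distinct
-- black edges get distinct colours, so |E_B| ≤ k.
--  (i)  As every cycle of G is odd, G is geodetic: two shortest u,v paths
--       leaving u differently would fork and close an even cycle (Geodetic).
--  (ii) If x y and w w′ are black edges, then d(w,x) ≠ d(w,y): otherwise the
--       geodesics from w to x and y part at a vertex z opposite to x y on a
--       cycle; z is white by (1), differs from w by (2), and since G is a cactus
--       it separates w from the cycle (CactusCycles), contradicting (4)
--       (BlackEdges).
--  (iii) Hence of two distinct black edges, two opposite ends lie two steps
--       farther apart than the other two; the unique geodesic between them runs
--       through both edges and, being rainbow, colours them differently
--       (RainbowGeodesics, Colours).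

module Submission where

open import Defs
open import Data.Nat using (ℕ; zero; suc; _+_; _*_; _≤_; _<_; _%_; _<ᵇ_; z≤n; s≤s; s≤s⁻¹)
open import Data.Nat.Properties
open import Data.Nat.ListAction using (sum)
open import Data.Fin using (Fin; toℕ) renaming (_≟_ to _≟F_)
import Data.Fin as Fin
import Data.Fin.Properties as Finₚ
open import Data.Bool using (Bool; true; false; T; not; _∧_; if_then_else_)
open import Data.Bool.Properties using (T-irrelevant; T-∧; T-not-≡)
open import Function.Bundles using (Equivalence)
open import Data.List
  using (List; []; _∷_; _++_; length; reverse; [_]; map; concatMap; cartesianProduct; allFin; filter; lookup; initLast; _∷ʳ′_)
open import Data.List.Properties using (∷-injectiveˡ; ∷-injectiveʳ; length-++; reverse-++; length-reverse; ++-assoc; unfold-reverse)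
open import Data.List.Membership.Propositional using (_∈_; _∉_; lose)
open import Data.List.Membership.Propositional.Properties using (∈-∃++; ∈-++⁺ˡ; ∈-++⁺ʳ; ∈-++⁻; ∈-lookup)
open import Data.List.Relation.Unary.Any using (Any; here; there; any?)
open import Data.List.Relation.Unary.Any.Properties using (reverse⁻)
open import Data.List.Relation.Unary.All as All using (All; []; _∷_)
open import Data.List.Relation.Unary.All.Properties using (¬Any⇒All¬; All¬⇒¬Any; ++⁻ˡ; all-filter)
open import Data.List.Relation.Unary.AllPairs using ([]; _∷_)
open import Data.List.Relation.Unary.Unique.Propositional using (Unique)
open import Data.List.Relation.Unary.Unique.Propositional.Properties using (++⁺; Unique[x∷xs]⇒x∉xs; cartesianProduct⁺; allFin⁺)
import Data.List.Relation.Unary.Unique.Propositional.Properties as Unique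
open import Data.List.Relation.Binary.Disjoint.Propositional using (Disjoint)
import Data.List.Relation.Binary.Permutation.Setoid as Perm
import Data.List.Relation.Binary.Permutation.Setoid.Properties as PermProps
open import Data.Product using (Σ; _×_; _,_; proj₁; proj₂)
open import Data.Sum using (_⊎_; inj₁; inj₂)
open import Data.Empty using (⊥; ⊥-elim)
open import Relation.Binary.PropositionalEquality hiding ([_])
open import Relation.Nullary using (¬_; Dec; yes; no)
open import Relation.Nullary.Decidable using (T?; _×-dec_)
open import Relation.Binary.Definitions using (DecidableEquality; tri<; tri≈; tri>)
open import Data.Nat.DivMod using (m*n%n≡0)
open import Data.Nat.Tactic.RingSolver using (solve-∀)

module _ {A : Set} where
  ∉-++ : ∀ {x : A} xs ys → x ∉ xs → x ∉ ys → x ∉ xs ++ ys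
  ∉-++ xs ys x∉xs x∉ys x∈ with ∈-++⁻ xs x∈
  ... | inj₁ x∈xs = x∉xs x∈xs
  ... | inj₂ x∈ys = x∉ys x∈ys

  length-mid : ∀ (xs : List A) y ys → length (xs ++ y ∷ ys) ≡ suc (length xs + length ys)
  length-mid xs y ys = trans (length-++ xs) (+-suc (length xs) (length ys))

  length-snoc : ∀ (xs : List A) y → length (xs ++ [ y ]) ≡ suc (length xs)
  length-snoc xs y = trans (length-mid xs y []) (cong suc (+-identityʳ (length xs)))

  snocView : ∀ (xs : List A) → xs ≡ [] ⊎ Σ (List A) λ ys → Σ A λ y → xs ≡ ys ++ [ y ]
  snocView xs with initLast xs
  ... | []       = inj₁ refl
  ... | ys ∷ʳ′ y = inj₂ (ys , y , refl)

  unique-suffix : ∀ xs {ys : List A} → Unique (xs ++ ys) → Unique ys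
  unique-suffix []       u       = u
  unique-suffix (_ ∷ xs) (_ ∷ u) = unique-suffix xs u

  unique-prefix : ∀ xs {ys : List A} → Unique (xs ++ ys) → Unique xs
  unique-prefix []       _          = []
  unique-prefix (_ ∷ xs) (x∉ ∷ u) = ++⁻ˡ xs x∉ ∷ unique-prefix xs u

  unique-reverse : ∀ {xs : List A} → Unique xs → Unique (reverse xs)
  unique-reverse {xs} = PermProps.Unique-resp-↭ (setoid A) (Perm.↭-sym (setoid A) (PermProps.↭-reverse (setoid A) xs))

  unique-lookup : ∀ {xs : List A} → Unique xs → ∀ i j → lookup xs i ≡ lookup xs j → i ≡ j
  unique-lookup (_ ∷ _)  Fin.zero    Fin.zero    _  = refl
  unique-lookup (x∉ ∷ _) Fin.zero    (Fin.suc j) eq = ⊥-elim (All¬⇒¬Any x∉ (subst (_∈ _) (sym eq) (∈-lookup j)))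
  unique-lookup (x∉ ∷ _) (Fin.suc i) Fin.zero    eq = ⊥-elim (All¬⇒¬Any x∉ (subst (_∈ _) eq (∈-lookup i)))
  unique-lookup (_ ∷ u)  (Fin.suc i) (Fin.suc j) eq = cong Fin.suc (unique-lookup u i j eq)

  unique-mid : ∀ xs {z : A} {ys} → Unique (xs ++ z ∷ ys) → z ∉ xs
  unique-mid (_ ∷ xs) (x∉ ∷ _) (here refl) = All¬⇒¬Any x∉ (∈-++⁺ʳ xs (here refl))
  unique-mid (_ ∷ xs) (_ ∷ u)  (there z∈)  = unique-mid xs u z∈

module _ {A : Set} (_≟_ : DecidableEquality A) where
  open import Data.List.Membership.DecPropositional _≟_ using (_∈?_)

  lastCommon : ∀ (P Q : List A) → Any (_∈ Q) P →
               Σ (List A) λ P₁ → Σ A λ z → Σ (List A) λ S → P ≡ P₁ ++ z ∷ S × z ∈ Q × All (_∉ Q) S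
  lastCommon (x ∷ P) Q common with any? (_∈? Q) P
  ... | yes later with lastCommon P Q later
  ...   | P₁ , z , S , refl , z∈Q , S∉Q = x ∷ P₁ , z , S , refl , z∈Q , S∉Q
  lastCommon (x ∷ P) Q (here x∈Q)    | no none = [] , x , P , refl , x∈Q , ¬Any⇒All¬ P none
  lastCommon (x ∷ P) Q (there later) | no none = ⊥-elim (none later)

  firstCommon : ∀ (L S : List A) → Any (_∈ S) L →
                Σ (List A) λ L₀ → Σ A λ c → Σ (List A) λ L₁ → L ≡ L₀ ++ c ∷ L₁ × c ∈ S × All (_∉ S) L₀
  firstCommon (x ∷ L) S common with x ∈? S
  ... | yes x∈S = [] , x , L , refl , x∈S , []
  firstCommon (x ∷ L) S (here x∈S)    | no x∉S = ⊥-elim (x∉S x∈S)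
  firstCommon (x ∷ L) S (there later) | no x∉S with firstCommon L S later
  ... | L₀ , c , L₁ , refl , c∈S , L₀∉S = x ∷ L₀ , c , L₁ , refl , c∈S , x∉S ∷ L₀∉S

module Walks (G : Graph) where
  open Graph G renaming (sym to adj-sym)
  open import Data.List.Membership.DecPropositional (_≟F_ {n}) using (_∈?_)

  walk-head : ∀ {u v p} → Walk G u v p → Σ (List (Fin n)) λ p′ → p ≡ u ∷ p′
  walk-head wnil        = _ , refl
  walk-head (wcons _ _) = _ , refl

  walk-start : ∀ {u v y p} → Walk G u v (y ∷ p) → y ≡ u
  walk-start wnil        = refl
  walk-start (wcons _ _) = refl

  walk-last : ∀ {u v p} → Walk G u v p → Σ (List (Fin n)) λ A → p ≡ A ++ [ v ]
  walk-last wnil = [] , refl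
  walk-last (wcons {u} _ w) with walk-last w
  ... | A , refl = u ∷ A , refl

  walk-adj : ∀ {u v x b q} → Walk G u v (x ∷ b ∷ q) → T (adj u b)
  walk-adj (wcons e w) with walk-start w
  ... | refl = e

  walk-tail-last : ∀ {u v x S} → Walk G u v (u ∷ x ∷ S) → Σ (List (Fin n)) λ S₀ → x ∷ S ≡ S₀ ++ [ v ]
  walk-tail-last (wcons _ w) = walk-last w

  walk-join : ∀ {u y v p B} → Walk G u y p → Walk G y v (y ∷ B) → Walk G u v (p ++ B)
  walk-join wnil         w₂ = w₂
  walk-join (wcons e w₁) w₂ = wcons e (walk-join w₁ w₂)

  walk-split : ∀ {u v y} A B → Walk G u v (A ++ y ∷ B) →
               Walk G u y (A ++ [ y ]) × Walk G y v (y ∷ B)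
  walk-split []      B wnil        = wnil , wnil
  walk-split []      B (wcons e w) = wnil , wcons e w
  walk-split (_ ∷ []) B (wcons e w) with walk-split [] B w
  ... | w₁ , w₂ = wcons e w₁ , w₂
  walk-split (_ ∷ a ∷ A) B (wcons e w) with walk-split (a ∷ A) B w
  ... | w₁ , w₂ = wcons e w₁ , w₂

  walk-end : ∀ {u v y} A → Walk G u v (A ++ [ y ]) → y ≡ v
  walk-end A w with walk-split A [] w
  ... | _ , wnil = refl

  walk-rev : ∀ {u v p} → Walk G u v p → Walk G v u (reverse p)
  walk-rev wnil = wnil
  walk-rev (wcons {u} {w} {v} {p} e wk) =
    subst (Walk G v u) (sym (unfold-reverse u p)) (walk-join (walk-rev wk) (wcons (adj-sym u w e) wnil))

  walk-end-mem : ∀ {u v p} → Walk G u v p → v ∈ p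
  walk-end-mem w with walk-last w
  ... | A , refl = ∈-++⁺ʳ A (here refl)

  loopErase : ∀ {a b L} → Walk G a b L → Σ (List (Fin n)) λ R → Walk G a b R × Unique R × (∀ {x} → x ∈ R → x ∈ L)
  loopErase wnil = _ , wnil , [] ∷ [] , λ x∈ → x∈
  loopErase {a} (wcons e w) with loopErase w
  ... | R , wR , uR , R⊆ with a ∈? R
  ...   | no a∉R = a ∷ R , wcons e wR , ¬Any⇒All¬ R a∉R ∷ uR ,
                   λ { (here x≡a) → here x≡a ; (there x∈R) → there (R⊆ x∈R) }
  ...   | yes a∈R with ∈-∃++ a∈R
  ...     | A , B , refl = a ∷ B , proj₂ (walk-split A B wR) , unique-suffix A uR , λ x∈ → there (R⊆ (∈-++⁺ʳ A x∈))

  reach-join : ∀ {z w₀ a b} → ReachAvoid G z w₀ a → ReachAvoid G z w₀ b → ReachAvoid G z a b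
  reach-join (L₁ , w₁ , z∉L₁) (L₂ , w₂ , z∉L₂) with walk-head w₂
  ... | L₂′ , refl = reverse L₁ ++ L₂′ , walk-join (walk-rev w₁) w₂ ,
                     ∉-++ (reverse L₁) L₂′ (λ z∈ → z∉L₁ (reverse⁻ z∈)) (λ z∈ → z∉L₂ (there z∈))

  same-start : ∀ {x x′ v p} → Walk G x v p → Walk G x′ v p → x ≡ x′
  same-start wnil         wnil         = refl
  same-start wnil         (wcons _ ())
  same-start (wcons _ ()) wnil
  same-start (wcons _ _)  (wcons _ _)  = refl

  -- adjacency is a proposition, so a walk is determined by its vertex list
  walk-irrelevant : ∀ {u v p} (w w′ : Walk G u v p) → w ≡ w′
  walk-irrelevant wnil        wnil          = refl
  walk-irrelevant wnil        (wcons _ ())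
  walk-irrelevant (wcons e w) (wcons e′ w′) with same-start w w′
  ... | refl with walk-irrelevant w w′
  ...   | refl = cong (λ e → wcons e w) (T-irrelevant e e′)

leastBelow : (Q : ℕ → Set) → (∀ ℓ → Dec (Q ℓ)) → ∀ N →
             (Σ ℕ λ ℓ → Q ℓ × (∀ j → j < ℓ → ¬ Q j)) ⊎ (∀ j → j < N → ¬ Q j)
leastBelow Q Q? zero = inj₂ λ _ ()
leastBelow Q Q? (suc N) with leastBelow Q Q? N
... | inj₁ found = inj₁ found
... | inj₂ none-below with Q? N
...   | yes qN = inj₁ (N , qN , none-below)
...   | no ¬qN = inj₂ λ j j<1+N → below-or-at (m≤n⇒m<n∨m≡n (s≤s⁻¹ j<1+N))
  where
    below-or-at : ∀ {j} → j < N ⊎ j ≡ N → ¬ Q j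
    below-or-at (inj₁ j<N)  = none-below _ j<N
    below-or-at (inj₂ refl) = ¬qN

leastWitness : (Q : ℕ → Set) → (∀ ℓ → Dec (Q ℓ)) → ∀ {m} → Q m →
               Σ ℕ λ ℓ → Q ℓ × (∀ j → j < ℓ → ¬ Q j)
leastWitness Q Q? {m} qm with leastBelow Q Q? (suc m)
... | inj₁ found = found
... | inj₂ none  = ⊥-elim (none m ≤-refl qm)

adjacent-values : ∀ {a b} → a ≤ suc b → b ≤ suc a → a ≢ b → b ≡ suc a ⊎ a ≡ suc b
adjacent-values {a} {b} a≤1+b b≤1+a a≢b with <-cmp a b
... | tri< a<b _ _ = inj₁ (≤-antisym b≤1+a a<b)
... | tri≈ _ a≡b _ = ⊥-elim (a≢b a≡b)
... | tri> _ _ b<a = inj₂ (≤-antisym a≤1+b b<a)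

module Distance (G : Graph) (conn : Connected G) where
  open Graph G renaming (sym to adj-sym)
  open Walks G

  walk-nonempty : ∀ {u v p} → Walk G u v p → 1 ≤ length p
  walk-nonempty wnil        = s≤s z≤n
  walk-nonempty (wcons _ _) = s≤s z≤n

  WalkOfLength : Fin n → Fin n → ℕ → Set
  WalkOfLength u v ℓ = Σ (List (Fin n)) λ p → Walk G u v p × length p ≡ ℓ

  -- existence of a walk with ℓ vertices is decidable (finitely many first steps)
  walkOfLength? : ∀ ℓ u v → Dec (WalkOfLength u v ℓ)
  walkOfLength? zero u v = no λ { (p , w , eq) → 1+n≰n (subst (1 ≤_) eq (walk-nonempty w)) }
  walkOfLength? (suc zero) u v with u ≟F v
  ... | yes refl = yes (u ∷ [] , wnil , refl)
  ... | no u≢v   = no λ { (_ , wnil , _) → u≢v refl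
                        ; (_ , wcons _ w , eq) → 1+n≰n (≤-trans (s≤s (walk-nonempty w)) (≤-reflexive eq)) }
  walkOfLength? (suc (suc ℓ)) u v with Finₚ.any? (λ w → T? (adj u w) ×-dec walkOfLength? (suc ℓ) w v)
  ... | yes (w , e , p , wk , eq) = yes (u ∷ p , wcons e wk , cong suc eq)
  ... | no ¬step = no λ { (_ , wnil , ())
                        ; (_ , wcons {w = w} e wk , eq) → ¬step (w , e , _ , wk , suc-injective eq) }

  opaque
   shortest : ∀ u v → Σ (List (Fin n)) λ p → Walk G u v p × (∀ q → Walk G u v q → length p ≤ length q)
   shortest u v with leastWitness (WalkOfLength u v) (λ ℓ → walkOfLength? ℓ u v) (proj₁ (conn u v) , proj₂ (conn u v) , refl)
   ... | _ , (p , w , refl) , minimal = p , w , λ q wq → ≮⇒≥ λ q<p → minimal _ q<p (q , wq , refl)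

  spath : Fin n → Fin n → List (Fin n)
  spath u v = proj₁ (shortest u v)

  spath-walk : ∀ u v → Walk G u v (spath u v)
  spath-walk u v = proj₁ (proj₂ (shortest u v))

  spath-tail : Fin n → Fin n → List (Fin n)
  spath-tail u v = proj₁ (walk-head (spath-walk u v))

  spath-head : ∀ u v → spath u v ≡ u ∷ spath-tail u v
  spath-head u v = proj₂ (walk-head (spath-walk u v))

  dist : Fin n → Fin n → ℕ
  dist u v = length (spath-tail u v)

  spath-length : ∀ u v → length (spath u v) ≡ suc (dist u v)
  spath-length u v = cong length (spath-head u v)

  dist-min : ∀ {u v q} → Walk G u v q → suc (dist u v) ≤ length q
  dist-min {u} {v} {q} w = subst (_≤ length q) (spath-length u v) (proj₂ (proj₂ (shortest u v)) q w)

  Geodesic : Fin n → Fin n → List (Fin n) → Set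
  Geodesic u v p = Walk G u v p × length p ≡ suc (dist u v)

  spath-geo : ∀ u v → Geodesic u v (spath u v)
  spath-geo u v = spath-walk u v , spath-length u v

  geo-min : ∀ {u v p} → Geodesic u v p → ∀ q → Walk G u v q → length p ≤ length q
  geo-min (_ , eq) q wq = subst (_≤ length q) (sym eq) (dist-min wq)

  -- a walk of minimal length repeats no vertex (a repetition could be cut out)
  minimal⇒unique : ∀ {u v p} → Walk G u v p → (∀ q → Walk G u v q → length p ≤ length q) → Unique p
  minimal⇒unique wnil _ = [] ∷ []
  minimal⇒unique {u} (wcons {p = p′} e wk) minimal =
    ¬Any⇒All¬ p′ u∉p′ ∷ minimal⇒unique wk (λ q wq → s≤s⁻¹ (minimal (u ∷ q) (wcons e wq)))
    where
      u∉p′ : u ∉ p′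
      u∉p′ u∈ with ∈-∃++ u∈
      ... | A , B , refl = 1+n≰n (begin
            suc (length B)          ≤⟨ m≤n+m (suc (length B)) (length A) ⟩
            length A + suc (length B) ≡⟨ length-++ A ⟨
            length (A ++ u ∷ B)     ≤⟨ s≤s⁻¹ (minimal (u ∷ B) (proj₂ (walk-split A B wk))) ⟩
            length B                ∎)
        where open ≤-Reasoning

  geo-unique : ∀ {u v p} → Geodesic u v p → Unique p
  geo-unique g = minimal⇒unique (proj₁ g) (geo-min g)

  geo-Dist : ∀ {u v p} → Geodesic u v p → Dist G u v (dist u v)
  geo-Dist {p = p} g = p , ((proj₁ g , geo-unique g) , geo-min g) , proj₂ g

  dist-sym : ∀ u v → dist u v ≡ dist v u
  dist-sym u v = ≤-antisym (dist-≤ u v) (dist-≤ v u)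
    where
      dist-≤ : ∀ u v → dist u v ≤ dist v u
      dist-≤ u v = s≤s⁻¹ (subst (suc (dist u v) ≤_) (trans (length-reverse (spath v u)) (spath-length v u))
                                (dist-min (walk-rev (spath-walk v u))))

  geo-rev : ∀ {u v p} → Geodesic u v p → Geodesic v u (reverse p)
  geo-rev {u} {v} {p} (w , len) = walk-rev w , trans (length-reverse p) (trans len (cong suc (dist-sym u v)))

  dist-tri : ∀ u v w → dist u w ≤ dist u v + dist v w
  dist-tri u v w = s≤s⁻¹ (subst (suc (dist u w) ≤_) len (dist-min joined))
    where
      joined : Walk G u w (spath u v ++ spath-tail v w)
      joined = walk-join (spath-walk u v) (subst (Walk G v w) (spath-head v w) (spath-walk v w))
      len : length (spath u v ++ spath-tail v w) ≡ suc (dist u v + dist v w)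
      len = trans (length-++ (spath u v)) (cong (_+ dist v w) (spath-length u v))

  dist-adj : ∀ {x y} w → T (adj x y) → dist w y ≤ suc (dist w x)
  dist-adj {x} {y} w e = s≤s⁻¹ (subst (suc (dist w y) ≤_) len (dist-min (walk-join (spath-walk w x) (wcons e wnil))))
    where
      len : length (spath w x ++ [ y ]) ≡ suc (suc (dist w x))
      len = trans (length-++ (spath w x)) (trans (cong (_+ 1) (spath-length w x)) (+-comm (suc (dist w x)) 1))

  dist-zero : ∀ {u v} → dist u v ≡ 0 → u ≡ v
  dist-zero {u} {v} d≡0 with spath-tail u v | spath-head u v
  ... | []    | eq = walk-end [] (subst (Walk G u v) eq (spath-walk u v))
  ... | _ ∷ _ | _  = ⊥-elim (1+n≢0 d≡0)

  Nearer : Fin n → Fin n → Fin n → Set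
  Nearer w x y = dist w y ≡ suc (dist w x)

  differ-by-one : ∀ w {x y} → T (adj x y) → dist w x ≢ dist w y → Nearer w x y ⊎ Nearer w y x
  differ-by-one w {x} {y} x~y = adjacent-values (dist-adj w (adj-sym x y x~y)) (dist-adj w x~y)

  -- both pieces of a geodesic cut at an inner vertex y are geodesics:
  -- each is at least as long as the distance it spans, and the sum is tight
  geo-cut-dist : ∀ {u v y} A B → Geodesic u v (A ++ y ∷ B) → dist u y ≡ length A × dist y v ≡ length B
  geo-cut-dist {u} {v} {y} A B (w , len) with walk-split A B w
  ... | w₁ , w₂ = ≤-antisym uy≤ (≮⇒≥ λ uy<A → <⇒≱ (+-mono-<-≤ uy<A yv≤) tight) ,
                  ≤-antisym yv≤ (≮⇒≥ λ yv<B → <⇒≱ (+-mono-≤-< uy≤ yv<B) tight)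
    where
      uy≤ : dist u y ≤ length A
      uy≤ = s≤s⁻¹ (subst (suc (dist u y) ≤_) (length-snoc A y) (dist-min w₁))
      yv≤ : dist y v ≤ length B
      yv≤ = s≤s⁻¹ (dist-min w₂)
      tight : length A + length B ≤ dist u y + dist y v
      tight = subst (_≤ dist u y + dist y v) (suc-injective (trans (sym len) (length-mid A y B))) (dist-tri u y v)

  geo-prefix : ∀ {u v y} A B → Geodesic u v (A ++ y ∷ B) → Geodesic u y (A ++ [ y ])
  geo-prefix {y = y} A B g =
    proj₁ (walk-split A B (proj₁ g)) , trans (length-snoc A y) (cong suc (sym (proj₁ (geo-cut-dist A B g))))

  geo-suffix : ∀ {u v y} A B → Geodesic u v (A ++ y ∷ B) → Geodesic y v (y ∷ B)
  geo-suffix A B g = proj₂ (walk-split A B (proj₁ g)) , cong suc (sym (proj₂ (geo-cut-dist A B g)))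

  geo-add : ∀ {u v y} A B → Geodesic u v (A ++ y ∷ B) → dist u v ≡ length A + dist y v
  geo-add {y = y} A B g = suc-injective (begin
    suc (dist _ _)                 ≡⟨ proj₂ g ⟨
    length (A ++ y ∷ B)            ≡⟨ length-mid A y B ⟩
    suc (length A + length B)      ≡⟨ cong (λ d → suc (length A + d)) (proj₂ (geo-cut-dist A B g)) ⟨
    suc (length A + dist y _)      ∎)
    where open ≡-Reasoning

  geo-beyond : ∀ {u v y x} A B → Geodesic u v (A ++ y ∷ B) → x ∈ B → length A < dist u x
  geo-beyond {u} {v} {y} {x} A B g x∈B with ∈-∃++ x∈B
  ... | B₁ , B₂ , refl = subst (length A <_) (sym dist≡) (s≤s (m≤m+n (length A) (length B₁)))
    where
      g′ : Geodesic u v ((A ++ y ∷ B₁) ++ x ∷ B₂)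
      g′ = subst (Geodesic u v) (sym (++-assoc A (y ∷ B₁) (x ∷ B₂))) g
      dist≡ : dist u x ≡ suc (length A + length B₁)
      dist≡ = trans (proj₁ (geo-cut-dist (A ++ y ∷ B₁) B₂ g′)) (length-mid A y B₁)

  geo-far-end : ∀ {u v y} A B → Geodesic u v (A ++ y ∷ B) → dist u y ≡ dist u v → y ≡ v
  geo-far-end {u} {v} {y} A B g eq = dist-zero (+-cancelˡ-≡ (length A) (dist y v) 0 (begin
    length A + dist y v ≡⟨ geo-add A B g ⟨
    dist u v            ≡⟨ eq ⟨
    dist u y            ≡⟨ proj₁ (geo-cut-dist A B g) ⟩
    length A            ≡⟨ +-identityʳ (length A) ⟨
    length A + 0        ∎))
    where open ≡-Reasoning

module Cycles (G : Graph) where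
  open Graph G renaming (sym to adj-sym)
  open Walks G

  closeCycle : ∀ {z s t p q} S′ R′ → Walk G z s (z ∷ p ∷ S′) → Walk G z t (z ∷ q ∷ R′) → T (adj s t) →
               Unique (z ∷ p ∷ S′) → Unique (z ∷ q ∷ R′) → Disjoint (p ∷ S′) (q ∷ R′) →
               Σ (Cycle G) λ C → Cycle.verts C ≡ z ∷ (p ∷ S′) ++ reverse (q ∷ R′) × Cycle.first C ≡ z
  closeCycle {z} {s} {t} {p} {q} S′ R′ wS (wcons z~q wR) s~t (z∉S ∷ uS) (z∉R ∷ uR) disjoint with walk-start wR
  ... | refl = record
    { first = z ; last = q ; verts = z ∷ (p ∷ S′) ++ reverse (q ∷ R′)
    ; walk  = walk-join wS (wcons s~t (walk-rev wR))
    ; uniq  = ¬Any⇒All¬ _ (∉-++ (p ∷ S′) _ (All¬⇒¬Any z∉S) (λ z∈ → All¬⇒¬Any z∉R (reverse⁻ z∈)))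
              ∷ ++⁺ uS (unique-reverse uR) (λ { (x∈S , x∈R) → disjoint (x∈S , reverse⁻ x∈R) })
    ; long  = s≤s (s≤s (subst (1 ≤_) (sym (trans (length-++ S′) (cong (length S′ +_) (length-reverse (q ∷ R′)))))
                                  (≤-trans (s≤s z≤n) (m≤n+m (suc (length R′)) (length S′)))))
    ; close = adj-sym z q z~q
    } , refl , refl

  junction-edge : ∀ (C : Cycle G) {z s t} S₀ R₀ →
                  Cycle.verts C ≡ z ∷ (S₀ ++ [ s ]) ++ reverse (R₀ ++ [ t ]) → EdgeOf G C s t
  junction-edge C {z} {s} {t} S₀ R₀ eq = inj₁ (z ∷ S₀ , reverse R₀ , trans eq (cong (z ∷_) (begin
    (S₀ ++ [ s ]) ++ reverse (R₀ ++ [ t ]) ≡⟨ cong ((S₀ ++ [ s ]) ++_) (reverse-++ R₀ [ t ]) ⟩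
    (S₀ ++ [ s ]) ++ t ∷ reverse R₀        ≡⟨ ++-assoc S₀ [ s ] (t ∷ reverse R₀) ⟩
    S₀ ++ s ∷ t ∷ reverse R₀               ∎)))
    where open ≡-Reasoning

module Geodetic (G : Graph) (conn : Connected G) (odd : ∀ (C : Cycle G) → length (Cycle.verts C) % 2 ≡ 1) where
  open Graph G renaming (sym to adj-sym)
  open Walks G
  open Distance G conn
  open Cycles G

  -- Geodesics P from w to s and Q from w to t, for an edge s t, part at the
  -- last vertex z of P lying on Q (at the same depth on both); beyond z they
  -- close up into a cycle through the edge s t.
  record Fork (w s t : Fin n) (P Q : List (Fin n)) : Set where
    field
      z           : Fin n
      P₁ S Q₁ R   : List (Fin n)
      P-split     : P ≡ P₁ ++ z ∷ S
      Q-split     : Q ≡ Q₁ ++ z ∷ R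
      same-depth  : length P₁ ≡ length Q₁
      cycle       : Cycle G
      cycle-verts : Cycle.verts cycle ≡ z ∷ S ++ reverse R
      cycle-first : Cycle.first cycle ≡ z
      cycle-edge  : EdgeOf G cycle s t

  opaque
    fork : ∀ {w s t P Q} → Geodesic w s P → Geodesic w t Q → s ∉ Q → t ∉ P → T (adj s t) → Fork w s t P Q
    fork {w} {s} {t} gP gQ s∉Q t∉P s~t with walk-head (proj₁ gP) | walk-head (proj₁ gQ)
    ... | P′ , refl | Q′ , refl with lastCommon _≟F_ (w ∷ P′) (w ∷ Q′) (here (here refl))
    ... | P₁ , z , [] , P≡ , z∈Q , _ =
      ⊥-elim (s∉Q (subst (_∈ w ∷ Q′) (walk-end P₁ (subst (Walk G w s) P≡ (proj₁ gP))) z∈Q))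
    ... | P₁ , z , p ∷ S′ , P≡ , z∈Q , S∉Q with ∈-∃++ z∈Q
    ...   | Q₁ , [] , Q≡ =
      ⊥-elim (t∉P (subst (_∈ w ∷ P′) (walk-end Q₁ (subst (Walk G w t) Q≡ (proj₁ gQ)))
                          (subst (z ∈_) (sym P≡) (∈-++⁺ʳ P₁ (here refl)))))
    ...   | Q₁ , q ∷ R′ , Q≡ = record
      { z = z ; P₁ = P₁ ; S = p ∷ S′ ; Q₁ = Q₁ ; R = q ∷ R′
      ; P-split = P≡ ; Q-split = Q≡
      ; same-depth = trans (sym (proj₁ (geo-cut-dist P₁ _ gP′))) (proj₁ (geo-cut-dist Q₁ _ gQ′))
      ; cycle = proj₁ cyc ; cycle-verts = proj₁ (proj₂ cyc) ; cycle-first = proj₂ (proj₂ cyc)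
      ; cycle-edge = junction-edge (proj₁ cyc) (proj₁ S-ends) (proj₁ R-ends)
                       (trans (proj₁ (proj₂ cyc)) (cong₂ (λ A B → z ∷ A ++ reverse B) (proj₂ S-ends) (proj₂ R-ends)))
      }
      where
        gP′ : Geodesic w s (P₁ ++ z ∷ p ∷ S′)
        gP′ = subst (Geodesic w s) P≡ gP
        gQ′ : Geodesic w t (Q₁ ++ z ∷ q ∷ R′)
        gQ′ = subst (Geodesic w t) Q≡ gQ
        gzs : Geodesic z s (z ∷ p ∷ S′)
        gzs = geo-suffix P₁ (p ∷ S′) gP′
        gzt : Geodesic z t (z ∷ q ∷ R′)
        gzt = geo-suffix Q₁ (q ∷ R′) gQ′
        disjoint : Disjoint (p ∷ S′) (q ∷ R′)
        disjoint (x∈S , x∈R) = All.lookup S∉Q x∈S (subst (_ ∈_) (sym Q≡) (∈-++⁺ʳ Q₁ (there x∈R)))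
        cyc : Σ (Cycle G) λ C → Cycle.verts C ≡ z ∷ (p ∷ S′) ++ reverse (q ∷ R′) × Cycle.first C ≡ z
        cyc = closeCycle S′ R′ (proj₁ gzs) (proj₁ gzt) s~t (geo-unique gzs) (geo-unique gzt) disjoint
        S-ends : Σ (List (Fin n)) λ S₀ → p ∷ S′ ≡ S₀ ++ [ s ]
        S-ends = walk-tail-last (proj₁ gzs)
        R-ends : Σ (List (Fin n)) λ R₀ → q ∷ R′ ≡ R₀ ++ [ t ]
        R-ends = walk-tail-last (proj₁ gzt)

  -- if P is one vertex longer than Q, the cycle of the fork would be even
  noUnevenFork : ∀ {w s t P Q} → Fork w s t P Q → length P ≢ suc (length Q)
  noUnevenFork {P = P} {Q} F |P|≡1+|Q| = 0≢1+n (trans (sym even) (odd cycle))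
    where
      open Fork F
      open ≡-Reasoning
      |S|≡1+|R| : length S ≡ suc (length R)
      |S|≡1+|R| = +-cancelˡ-≡ (length P₁) _ _ (suc-injective (begin
        suc (length P₁ + length S)       ≡⟨ length-mid P₁ z S ⟨
        length (P₁ ++ z ∷ S)             ≡⟨ cong length P-split ⟨
        length P                         ≡⟨ |P|≡1+|Q| ⟩
        suc (length Q)                   ≡⟨ cong (λ L → suc (length L)) Q-split ⟩
        suc (length (Q₁ ++ z ∷ R))       ≡⟨ cong suc (length-mid Q₁ z R) ⟩
        suc (suc (length Q₁ + length R)) ≡⟨ cong (λ d → suc (suc (d + length R))) same-depth ⟨
        suc (suc (length P₁ + length R)) ≡⟨ cong suc (+-suc (length P₁) (length R)) ⟨
        suc (length P₁ + suc (length R)) ∎))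
      |C|≡2+2|R| : length (Cycle.verts cycle) ≡ suc (length R) * 2
      |C|≡2+2|R| = begin
        length (Cycle.verts cycle)          ≡⟨ cong length cycle-verts ⟩
        suc (length (S ++ reverse R))       ≡⟨ cong suc (length-++ S) ⟩
        suc (length S + length (reverse R)) ≡⟨ cong₂ (λ a b → suc (a + b)) |S|≡1+|R| (length-reverse R) ⟩
        suc (suc (length R) + length R)     ≡⟨ twice (length R) ⟩
        suc (length R) * 2                  ∎
        where
          twice : ∀ r → suc (suc r + r) ≡ suc r * 2
          twice = solve-∀
      even : length (Cycle.verts cycle) % 2 ≡ 0
      even = trans (cong (_% 2) |C|≡2+2|R|) (m*n%n≡0 (suc (length R)) 2)

  -- two u,v geodesics leave u through the same neighbour; otherwise the
  -- reversed geodesics from v would form an uneven fork at the edge u b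
  sameSecond : ∀ {u v x y a b} p q → Geodesic u v (x ∷ a ∷ p) → Geodesic u v (y ∷ b ∷ q) → a ≡ b
  sameSecond {u} {v} {x} {y} {a} {b} p q gp gq with walk-start (proj₁ gp) | walk-start (proj₁ gq) | a ≟F b
  ... | _    | _    | yes a≡b = a≡b
  ... | refl | refl | no a≢b = ⊥-elim (noUnevenFork (fork (geo-rev gp) (geo-rev gbv) u∉Q b∉P u~b) lengths)
    where
      u~b : T (adj u b)
      u~b = walk-adj (proj₁ gq)
      gbv : Geodesic b v (b ∷ q)
      gbv = geo-suffix (u ∷ []) q gq
      u∉Q : u ∉ reverse (b ∷ q)
      u∉Q u∈ = Unique[x∷xs]⇒x∉xs (geo-unique gq) (reverse⁻ u∈)
      b∉P : b ∉ reverse (u ∷ a ∷ p)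
      b∉P b∈ with reverse⁻ {xs = u ∷ a ∷ p} b∈
      ... | here b≡u          = irrefl u (subst (λ x → T (adj u x)) b≡u u~b)
      ... | there (here b≡a)  = a≢b (sym b≡a)
      ... | there (there b∈p) = <-irrefl (sym (proj₁ (geo-cut-dist (u ∷ []) q gq))) (geo-beyond (u ∷ []) p gp b∈p)
      lengths : length (reverse (u ∷ a ∷ p)) ≡ suc (length (reverse (b ∷ q)))
      lengths = begin
        length (reverse (u ∷ a ∷ p)) ≡⟨ length-reverse (u ∷ a ∷ p) ⟩
        length (u ∷ a ∷ p)           ≡⟨ proj₂ gp ⟩
        suc (dist u v)               ≡⟨ proj₂ gq ⟨
        suc (length (b ∷ q))         ≡⟨ cong suc (length-reverse (b ∷ q)) ⟨
        suc (length (reverse (b ∷ q))) ∎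
        where open ≡-Reasoning

  geodetic : ∀ {u v} p q → Geodesic u v p → Geodesic u v q → p ≡ q
  geodetic [] _ (() , _) _
  geodetic _ [] _ (() , _)
  geodetic (x ∷ []) (y ∷ []) gp gq = cong [_] (trans (walk-start (proj₁ gp)) (sym (walk-start (proj₁ gq))))
  geodetic (_ ∷ []) (_ ∷ _ ∷ _) gp gq = ⊥-elim (0≢1+n (suc-injective (trans (proj₂ gp) (sym (proj₂ gq)))))
  geodetic (_ ∷ _ ∷ _) (_ ∷ []) gp gq = ⊥-elim (0≢1+n (suc-injective (trans (proj₂ gq) (sym (proj₂ gp)))))
  geodetic {v = v} (x ∷ a ∷ p) (y ∷ b ∷ q) gp gq =
    cong₂ _∷_ (trans (walk-start (proj₁ gp)) (sym (walk-start (proj₁ gq))))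
              (geodetic (a ∷ p) (b ∷ q) (geo-suffix (x ∷ []) p gp)
                        (subst (λ c → Geodesic c v (b ∷ q)) (sym (sameSecond p q gp gq)) (geo-suffix (y ∷ []) q gq)))

  -- edges x₁ y₁ and x₂ y₂ with x₁ the nearer end to x₂ and y₁ the nearer end
  -- to y₂ coincide: x₁ … x₂ y₂ and x₁ y₁ … y₂ are both x₁,y₂ geodesics
  parallel-edges : ∀ {x₁ y₁ x₂ y₂} → T (adj x₁ y₁) → T (adj x₂ y₂) →
                   Nearer x₂ x₁ y₁ → Nearer y₂ y₁ x₁ → x₁ ≡ x₂ × y₁ ≡ y₂
  parallel-edges {x₁} {y₁} {x₂} {y₂} x₁~y₁ x₂~y₂ x₁-nearer y₁-nearer = cases (spath-tail x₁ x₂) refl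
    where
      y₁x₂ : dist y₁ x₂ ≡ suc (dist x₁ x₂)
      y₁x₂ = trans (dist-sym y₁ x₂) (trans x₁-nearer (cong suc (dist-sym x₂ x₁)))
      x₁y₂ : dist x₁ y₂ ≡ suc (dist y₁ y₂)
      x₁y₂ = trans (dist-sym x₁ y₂) (trans y₁-nearer (cong suc (dist-sym y₂ y₁)))
      same-gap : dist x₁ x₂ ≡ dist y₁ y₂
      same-gap = ≤-antisym (s≤s⁻¹ (subst (_≤ suc (dist y₁ y₂)) y₁x₂ (dist-adj y₁ (adj-sym x₂ y₂ x₂~y₂))))
                           (s≤s⁻¹ (subst (_≤ suc (dist x₁ x₂)) x₁y₂ (dist-adj x₁ x₂~y₂)))
      via-x₂ : Geodesic x₁ y₂ (spath x₁ x₂ ++ [ y₂ ])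
      via-x₂ = walk-join (spath-walk x₁ x₂) (wcons x₂~y₂ wnil) ,
               trans (length-snoc (spath x₁ x₂) y₂)
                     (cong suc (trans (spath-length x₁ x₂) (trans (cong suc same-gap) (sym x₁y₂))))
      via-y₁ : Geodesic x₁ y₂ (x₁ ∷ spath y₁ y₂)
      via-y₁ = wcons x₁~y₁ (spath-walk y₁ y₂) , cong suc (trans (spath-length y₁ y₂) (sym x₁y₂))
      tails : spath-tail x₁ x₂ ++ [ y₂ ] ≡ y₁ ∷ spath-tail y₁ y₂
      tails = trans (∷-injectiveʳ (trans (cong (_++ [ y₂ ]) (sym (spath-head x₁ x₂))) (geodetic _ _ via-x₂ via-y₁)))
                    (spath-head y₁ y₂)
      cases : ∀ t → t ≡ spath-tail x₁ x₂ → x₁ ≡ x₂ × y₁ ≡ y₂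
      cases []       t≡ = dist-zero (cong length (sym t≡)) , sym (∷-injectiveˡ (trans (cong (_++ [ y₂ ]) t≡) tails))
      -- otherwise y₁ follows x₁ on the x₁,x₂ geodesic, yet is farther from x₂
      cases (c ∷ rest) t≡ = ⊥-elim (<-irrefl too-far (m<n⇒m<1+n (n<1+n (dist x₁ x₂))))
        where
          c≡y₁ : c ≡ y₁
          c≡y₁ = ∷-injectiveˡ (trans (cong (_++ [ y₂ ]) t≡) tails)
          g : Geodesic x₁ x₂ (x₁ ∷ c ∷ rest)
          g = subst (Geodesic x₁ x₂) (trans (spath-head x₁ x₂) (cong (x₁ ∷_) (sym t≡))) (spath-geo x₁ x₂)
          too-far : dist x₁ x₂ ≡ suc (suc (dist x₁ x₂))
          too-far = trans (geo-add (x₁ ∷ []) rest g) (cong suc (trans (cong (λ v → dist v x₂) c≡y₁) y₁x₂))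

-- In a cactus, a cycle C starting at z cannot be left along an edge z z′ and
-- re-entered without passing z again: the detour would close a second cycle D
-- sharing the closing edge of C, hence all edges with C, including z z′.
module CactusCycles (G : Graph) (cactus : Cactus G) where
  open Graph G renaming (sym to adj-sym)
  open Walks G

  edge-flip : ∀ {C : Cycle G} {a b} → EdgeOf G C a b → EdgeOf G C b a
  edge-flip (inj₁ e)               = inj₂ (inj₁ e)
  edge-flip (inj₂ (inj₁ e))        = inj₁ e
  edge-flip (inj₂ (inj₂ (inj₁ e))) = inj₂ (inj₂ (inj₂ e))
  edge-flip (inj₂ (inj₂ (inj₂ e))) = inj₂ (inj₂ (inj₁ e))

  edge-mem : ∀ (C : Cycle G) {a b} → EdgeOf G C a b → b ∈ Cycle.verts C
  edge-mem C (inj₁ (as , _ , eq))        = subst (_ ∈_) (sym eq) (∈-++⁺ʳ as (there (here refl)))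
  edge-mem C (inj₂ (inj₁ (as , _ , eq))) = subst (_ ∈_) (sym eq) (∈-++⁺ʳ as (here refl))
  edge-mem C (inj₂ (inj₂ (inj₁ (_ , refl)))) with walk-head (Cycle.walk C)
  ... | _ , eq = subst (_ ∈_) (sym eq) (here refl)
  edge-mem C (inj₂ (inj₂ (inj₂ (refl , _)))) = walk-end-mem (Cycle.walk C)

  detourCycle : ∀ (C : Cycle G) {z z′ c} L₀ α β → Cycle.first C ≡ z → Cycle.verts C ≡ z ∷ α ++ c ∷ β →
                T (adj z′ z) → Walk G z′ c ((z′ ∷ L₀) ++ [ c ]) → Unique (z′ ∷ L₀) → z ∉ z′ ∷ L₀ →
                All (_∉ Cycle.verts C) (z′ ∷ L₀) →
                Σ (Cycle G) λ D → Cycle.verts D ≡ z ∷ (z′ ∷ L₀) ++ c ∷ β ×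
                                  Cycle.first D ≡ z × Cycle.last D ≡ Cycle.last C
  detourCycle C {z} {z′} {c} L₀ α β fC C≡ z′~z toC uL₀ z∉L₀ L₀∉C = record
    { first = z ; last = Cycle.last C ; verts = z ∷ (z′ ∷ L₀) ++ c ∷ β
    ; walk  = wcons (adj-sym z′ z z′~z) (subst (Walk G z′ (Cycle.last C)) (++-assoc (z′ ∷ L₀) [ c ] β) (walk-join toC alongC))
    ; uniq  = ¬Any⇒All¬ _ z∉D ∷ ++⁺ uL₀ (unique-suffix (z ∷ α) uC) detour∩C
    ; long  = s≤s (s≤s (subst (1 ≤_) (sym (length-mid L₀ c β)) (s≤s z≤n)))
    ; close = subst (λ y → T (adj (Cycle.last C) y)) fC (Cycle.close C)
    } , refl , refl , refl
    where
      uC : Unique (z ∷ α ++ c ∷ β)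
      uC = subst Unique C≡ (Cycle.uniq C)
      alongC : Walk G c (Cycle.last C) (c ∷ β)
      alongC = proj₂ (walk-split (z ∷ α) β (subst₂ (λ f l → Walk G f (Cycle.last C) l) fC C≡ (Cycle.walk C)))
      z∉D : z ∉ (z′ ∷ L₀) ++ c ∷ β
      z∉D = ∉-++ (z′ ∷ L₀) (c ∷ β) z∉L₀ (λ z∈ → Unique[x∷xs]⇒x∉xs uC (∈-++⁺ʳ α z∈))
      detour∩C : Disjoint (z′ ∷ L₀) (c ∷ β)
      detour∩C (y∈L₀ , y∈β) = All.lookup L₀∉C y∈L₀ (subst (_ ∈_) (sym C≡) (there (∈-++⁺ʳ α y∈β)))

  noBypass : ∀ (C : Cycle G) {z z′ x L} → Cycle.first C ≡ z → z′ ∉ Cycle.verts C → T (adj z′ z) →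
             Walk G z′ x L → z ∉ L → x ∈ Cycle.verts C → ⊥
  noBypass C {z} {z′} fC z′∉C z′~z wL z∉L x∈C with loopErase wL
  ... | R , wR , uR , R⊆L with firstCommon _≟F_ R (Cycle.verts C) (lose (walk-end-mem wR) x∈C)
  ... | [] , c , _ , refl , c∈C , _ = z′∉C (subst (_∈ Cycle.verts C) (walk-start wR) c∈C)
  ... | _ ∷ L₀ , c , R₁ , refl , c∈C , L₀∉C with walk-start wR | walk-head (Cycle.walk C)
  ... | refl | rest , C≡ with subst (c ∈_) (trans C≡ (cong (_∷ rest) fC)) c∈C
  ... | here refl = z∉L (R⊆L (∈-++⁺ʳ (z′ ∷ L₀) (here refl)))
  ... | there c∈rest with ∈-∃++ c∈rest
  ... | α , β , refl with detourCycle C L₀ α β fC (trans C≡ (cong (_∷ α ++ c ∷ β) fC)) z′~z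
                            (proj₁ (walk-split (z′ ∷ L₀) R₁ wR)) (unique-prefix (z′ ∷ L₀) uR)
                            (λ z∈ → z∉L (R⊆L (∈-++⁺ˡ z∈))) L₀∉C
  ... | D , D≡ , fD , lD = z′∉C (edge-mem C (proj₁ (cactus D C _ _ closingD closingC z z′) (inj₁ ([] , _ , D≡))))
    where
      closingD : EdgeOf G D (Cycle.last C) z
      closingD = inj₂ (inj₂ (inj₁ (sym lD , sym fD)))
      closingC : EdgeOf G C (Cycle.last C) z
      closingC = inj₂ (inj₂ (inj₁ (refl , sym fC)))

module RainbowGeodesics (G : Graph) (conn : Connected G) (odd : ∀ (C : Cycle G) → length (Cycle.verts C) % 2 ≡ 1)
                        {k : ℕ} (c : Colouring G k) (rainbow : StrongRainbow G c) where
  open Graph G renaming (sym to adj-sym)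
  open Walks G
  open Distance G conn
  open Geodetic G conn odd
  open Colouring c

  col-flip : ∀ {u v} (e : T (adj u v)) (e′ : T (adj v u)) → col u v e ≡ col v u e′
  col-flip {u} {v} e e′ = trans (col-sym u v e) (cong (col v u) (T-irrelevant _ e′))

  last-colour : ∀ {a b d p} (w : Walk G a b p) (b~d : T (adj b d)) → col b d b~d ∈ walkColours G c (walk-join w (wcons b~d wnil))
  last-colour wnil        b~d = here refl
  last-colour (wcons _ w) b~d = there (last-colour w b~d)

  -- if dist a d = dist b c′ + 2 for edges a b and c′ d, the only a,d geodesic
  -- runs a, b, …, c′, d; being rainbow, it gives a b and c′ d distinct colours
  far-edges-differ : ∀ {a b c′ d} (a~b : T (adj a b)) (c′~d : T (adj c′ d)) →
                     dist a d ≡ suc (suc (dist b c′)) → col a b a~b ≢ col c′ d c′~d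
  far-edges-differ {a} {b} {c′} {d} a~b c′~d far same with rainbow a d
  ... | p , w , (_ , minimal) , distinct
    with geodetic p p₀ (w , ≤-antisym (≤-trans (minimal p₀ w₀) (≤-reflexive |p₀|)) (dist-min w)) (w₀ , |p₀|)
    where
      p₀ : List (Fin n)
      p₀ = a ∷ spath b c′ ++ [ d ]
      w₀ : Walk G a d p₀
      w₀ = wcons a~b (walk-join (spath-walk b c′) (wcons c′~d wnil))
      |p₀| : length p₀ ≡ suc (dist a d)
      |p₀| = cong suc (trans (length-snoc (spath b c′) d) (trans (cong suc (spath-length b c′)) (sym far)))
  ... | refl with walk-irrelevant w (wcons a~b (walk-join (spath-walk b c′) (wcons c′~d wnil)))
  ...   | refl = Unique[x∷xs]⇒x∉xs distinct c′d-later
    where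
      c′d-later : col a b a~b ∈ walkColours G c (walk-join (spath-walk b c′) (wcons c′~d wnil))
      c′d-later = subst (_∈ walkColours G c (walk-join (spath-walk b c′) (wcons c′~d wnil))) (sym same)
                        (last-colour (spath-walk b c′) c′~d)

count≤ : ∀ {X : Set} {k} (g : X → Bool) (xs : List X) → Unique xs →
         (label : ∀ x → T (g x) → Fin k) → (∀ {x y} gx gy → label x gx ≡ label y gy → x ≡ y) →
         sum (map (λ x → if g x then 1 else 0) xs) ≤ k
count≤ {X} {k} g xs unique-xs label label-injective =
  subst (_≤ k) (sym (count≡length xs)) (Finₚ.injective⇒≤ lookup-label-injective)
  where
    selected : List X
    selected = filter (λ x → T? (g x)) xs

    count≡length : ∀ ys → sum (map (λ x → if g x then 1 else 0) ys) ≡ length (filter (λ x → T? (g x)) ys)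
    count≡length [] = refl
    count≡length (y ∷ ys) with g y
    ... | true  = cong suc (count≡length ys)
    ... | false = count≡length ys

    lookup-label : Fin (length selected) → Fin k
    lookup-label i = label (lookup selected i) (All.lookup (all-filter (λ x → T? (g x)) xs) (∈-lookup i))

    lookup-label-injective : ∀ {i j} → lookup-label i ≡ lookup-label j → i ≡ j
    lookup-label-injective {i} {j} same =
      unique-lookup (Unique.filter⁺ (λ x → T? (g x)) unique-xs) i j (label-injective _ _ same)

allPairs-unique : ∀ n → Unique (concatMap (λ u → map (λ v → (u , v)) (allFin n)) (allFin n))
allPairs-unique n = subst Unique (sym (concatMap≡cartesianProduct (allFin n))) (cartesianProduct⁺ (allFin⁺ n) (allFin⁺ n))
  where
    concatMap≡cartesianProduct : ∀ {A B : Set} (xs : List A) {ys : List B} →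
                                 concatMap (λ u → map (λ v → (u , v)) ys) xs ≡ cartesianProduct xs ys
    concatMap≡cartesianProduct []       = refl
    concatMap≡cartesianProduct (x ∷ xs) {ys} = cong (map (λ v → (x , v)) ys ++_) (concatMap≡cartesianProduct xs)

ordered-pair : ∀ {n} {u v u′ v′ : Fin n} → toℕ u < toℕ v → toℕ u′ < toℕ v′ →
               (u ≡ u′ × v ≡ v′) ⊎ (u ≡ v′ × v ≡ u′) → (u , v) ≡ (u′ , v′)
ordered-pair _   _     (inj₁ (refl , refl)) = refl
ordered-pair u<v u′<v′ (inj₂ (refl , refl)) = ⊥-elim (<-asym u<v u′<v′)

-- Seen from an endpoint w of a black edge, the two
-- ends of a black edge x y are never equidistant.  Otherwise the geodesics from
-- w to x and y fork at a vertex z opposite to x y on the resulting cycle; by (1)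
-- z is white, by (2) z ≠ w, so z is a white cut vertex separating w from the
-- cycle, contradicting (4) since black edges lie on both sides.
module BlackEdges (G : Graph) (conn : Connected G) (odd : ∀ (C : Cycle G) → length (Cycle.verts C) % 2 ≡ 1)
                  (cactus : Cactus G) (P : BWPartition G) where
  open Graph G renaming (sym to adj-sym)
  open Walks G
  open Distance G conn
  open Geodetic G conn odd
  open CactusCycles G cactus
  open BWPartition P

  module Balanced {w x y} (x~y : T (adj x y)) (balanced : dist w x ≡ dist w y) where
    x∉Q : x ∉ spath w y
    x∉Q x∈ with ∈-∃++ x∈
    ... | A , B , eq = irrefl x (subst (λ v → T (adj x v)) (sym x≡y) x~y)
      where
        x≡y : x ≡ y
        x≡y = geo-far-end A B (subst (Geodesic w y) eq (spath-geo w y)) balanced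

    y∉P : y ∉ spath w x
    y∉P y∈ with ∈-∃++ y∈
    ... | A , B , eq = irrefl x (subst (λ v → T (adj x v)) y≡x x~y)
      where
        y≡x : y ≡ x
        y≡x = geo-far-end A B (subst (Geodesic w x) eq (spath-geo w x)) (sym balanced)

    balancedFork : Fork w x y (spath w x) (spath w y)
    balancedFork = fork (spath-geo w x) (spath-geo w y) x∉Q y∉P x~y

    open Fork balancedFork public

    gP : Geodesic w x (P₁ ++ z ∷ S)
    gP = subst (Geodesic w x) P-split (spath-geo w x)

    gQ : Geodesic w y (Q₁ ++ z ∷ R)
    gQ = subst (Geodesic w y) Q-split (spath-geo w y)

    apex-equidistant : dist z x ≡ dist z y
    apex-equidistant = +-cancelˡ-≡ (length P₁) _ _ (begin
      length P₁ + dist z x ≡⟨ geo-add P₁ S gP ⟨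
      dist w x             ≡⟨ balanced ⟩
      dist w y             ≡⟨ geo-add Q₁ R gQ ⟩
      length Q₁ + dist z y ≡⟨ cong (_+ dist z y) same-depth ⟨
      length P₁ + dist z y ∎)
      where open ≡-Reasoning

    -- condition (1): z is opposite to x y on the cycle, so z is white
    apex-white : T (eb x y) → black z ≡ false
    apex-white xy-black = Equivalence.to T-not-≡ (subst T eb≡ xy-black)
      where
        eb≡ : eb x y ≡ not (black z)
        eb≡ = cond1 cycle x y cycle-edge z (subst (z ∈_) (sym cycle-verts) (here refl)) (dist z x)
                    (geo-Dist (spath-geo z x)) (subst (Dist G z y) (sym apex-equidistant) (geo-Dist (spath-geo z y)))

    x≢z : x ≢ z
    x≢z x≡z = x∉Q (subst (_∈ spath w y) (sym x≡z) (subst (z ∈_) (sym Q-split) (∈-++⁺ʳ Q₁ (here refl))))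

    x∈C : x ∈ Cycle.verts cycle
    x∈C = edge-mem cycle (edge-flip {C = cycle} cycle-edge)

    module Predecessor {I z′} (P₁≡ : P₁ ≡ I ++ [ z′ ]) where
      g₃ : Geodesic w x (I ++ z′ ∷ z ∷ S)
      g₃ = subst (Geodesic w x) (trans (cong (_++ z ∷ S) P₁≡) (++-assoc I [ z′ ] (z ∷ S))) gP

      toZ′ : Geodesic w z′ (I ++ [ z′ ])
      toZ′ = geo-prefix I (z ∷ S) g₃

      fromZ′ : Geodesic z′ x (z′ ∷ z ∷ S)
      fromZ′ = geo-suffix I (z ∷ S) g₃

      z′~z : T (adj z′ z)
      z′~z = walk-adj (proj₁ fromZ′)

      -- z′ is one step closer to w than z, while R lies beyond z on Q
      z′∉R : z′ ∉ R
      z′∉R z′∈R = <-asym (geo-beyond Q₁ R gQ z′∈R) (begin-strict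
        dist w z′      ≡⟨ proj₁ (geo-cut-dist I (z ∷ S) g₃) ⟩
        length I       <⟨ n<1+n (length I) ⟩
        suc (length I) ≡⟨ trans (cong length P₁≡) (length-snoc I z′) ⟨
        length P₁      ≡⟨ same-depth ⟩
        length Q₁      ∎)
        where open ≤-Reasoning

      z′∉zS : z′ ∉ z ∷ S
      z′∉zS = Unique[x∷xs]⇒x∉xs (geo-unique fromZ′)

      z′∉C : z′ ∉ Cycle.verts cycle
      z′∉C z′∈ = ∉-++ (z ∷ S) (reverse R) z′∉zS (λ z′∈R → z′∉R (reverse⁻ z′∈R))
                      (subst (z′ ∈_) cycle-verts z′∈)

      z∉toZ′ : z ∉ I ++ [ z′ ]
      z∉toZ′ = unique-mid (I ++ [ z′ ]) (geo-unique (subst (λ A → Geodesic w x (A ++ z ∷ S)) P₁≡ gP))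

      -- a walk from w to x avoiding z, preceded by the way back from z′ to w,
      -- would bypass z
      no-detour : ¬ ReachAvoid G z w x
      no-detour (L , wL , z∉L) with walk-head wL
      ... | L′ , refl = noBypass cycle cycle-first z′∉C z′~z (walk-join (walk-rev (proj₁ toZ′)) wL)
                          (∉-++ (reverse (I ++ [ z′ ])) L′ (λ z∈ → z∉toZ′ (reverse⁻ z∈)) (λ z∈ → z∉L (there z∈)))
                          x∈C

    apex-separates : z ≢ w → ¬ ReachAvoid G z w x
    apex-separates z≢w = by-cases (snocView P₁)
      where
        by-cases : P₁ ≡ [] ⊎ (Σ (List (Fin n)) λ I → Σ (Fin n) λ z′ → P₁ ≡ I ++ [ z′ ]) → ¬ ReachAvoid G z w x
        by-cases (inj₁ P₁≡[])         =
          ⊥-elim (z≢w (walk-start (proj₁ (subst (λ A → Geodesic w x (A ++ z ∷ S)) P₁≡[] gP))))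
        by-cases (inj₂ (_ , _ , P₁≡)) = Predecessor.no-detour P₁≡

  unbalanced : ∀ {x y w w′} → T (adj x y) → T (eb x y) → T (adj w w′) → T (eb w w′) → dist w x ≢ dist w y
  unbalanced {x} {y} {w} {w′} x~y xy-black w~w′ ww′-black balanced = apex (z ≟F w)
    where
      open Balanced x~y balanced
      z-white : black z ≡ false
      z-white = apex-white xy-black
      -- condition (2): w lies on a black edge, so it is black
      w-black : black w ≡ true
      w-black = proj₁ (cond2 w w′ w~w′ ww′-black)
      true≢false : true ≢ false
      true≢false ()
      -- condition (4): the white cut vertex z has all black edges, in
      -- particular w w′ and x y, on one side
      one-side : (Σ (Fin n) λ w₀ → w₀ ≢ z ×
                    (∀ a b → T (adj a b) → T (eb a b) → ReachAvoid G z w₀ a × ReachAvoid G z w₀ b)) →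
                 ReachAvoid G z w x
      one-side (_ , _ , component) = reach-join (proj₁ (component w w′ w~w′ ww′-black)) (proj₁ (component x y x~y xy-black))
      apex : Dec (z ≡ w) → ⊥
      apex (yes z≡w) = true≢false (trans (sym w-black) (subst (λ v → black v ≡ false) z≡w z-white))
      apex (no z≢w)  = apex-separates z≢w (one-side (cond4 z z-white z-cut))
        where
          z-cut : CutVertex G z
          z-cut = w , x , (λ w≡z → z≢w (sym w≡z)) , x≢z , apex-separates z≢w

  black-sides : ∀ {x y w w′} → T (adj x y) → T (eb x y) → T (adj w w′) → T (eb w w′) →
                Nearer w x y ⊎ Nearer w y x
  black-sides x~y xy-black w~w′ ww′-black = differ-by-one _ x~y (unbalanced x~y xy-black w~w′ ww′-black)

  eb-flip : ∀ {x y} (x~y : T (adj x y)) → T (eb x y) → T (eb y x)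
  eb-flip {x} {y} x~y = subst T (eb-sym x y x~y)

  module Colours {k : ℕ} (c : Colouring G k) (rainbow : StrongRainbow G c) where
    open Colouring c
    open RainbowGeodesics G conn odd c rainbow

    SameEdge : Fin n → Fin n → Fin n → Fin n → Set
    SameEdge x₁ y₁ x₂ y₂ = (x₁ ≡ x₂ × y₁ ≡ y₂) ⊎ (x₁ ≡ y₂ × y₁ ≡ x₂)

    -- with x₁ the end of x₁ y₁ nearer to x₂: either the edges are parallel
    -- (hence equal), or two opposite ends are two steps farther apart than the
    -- other two, and the geodesic between them separates the colours
    oriented : ∀ {x₁ y₁ x₂ y₂} (x₁~y₁ : T (adj x₁ y₁)) → T (eb x₁ y₁) → (x₂~y₂ : T (adj x₂ y₂)) → T (eb x₂ y₂) →
               Nearer x₂ x₁ y₁ → col x₁ y₁ x₁~y₁ ≡ col x₂ y₂ x₂~y₂ → x₁ ≡ x₂ × y₁ ≡ y₂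
    oriented {x₁} {y₁} {x₂} {y₂} x₁~y₁ b₁ x₂~y₂ b₂ x₁-nearer same =
      seen-from-y₂ (black-sides x₁~y₁ b₁ y₂~x₂ (eb-flip x₂~y₂ b₂))
      where
        y₁~x₁ : T (adj y₁ x₁)
        y₁~x₁ = adj-sym x₁ y₁ x₁~y₁
        y₂~x₂ : T (adj y₂ x₂)
        y₂~x₂ = adj-sym x₂ y₂ x₂~y₂
        same′ : col y₁ x₁ y₁~x₁ ≡ col x₂ y₂ x₂~y₂
        same′ = trans (col-flip y₁~x₁ x₁~y₁) same

        seen-from-x₁ : Nearer y₂ x₁ y₁ → Nearer x₁ x₂ y₂ ⊎ Nearer x₁ y₂ x₂ → ⊥
        seen-from-x₁ x₁-nearer-y₂ (inj₁ x₂-nearer-x₁) = far-edges-differ y₁~x₁ x₂~y₂ far same′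
          where
            far : dist y₁ y₂ ≡ suc (suc (dist x₁ x₂))
            far = trans (dist-sym y₁ y₂) (trans x₁-nearer-y₂ (cong suc (trans (dist-sym y₂ x₁) x₂-nearer-x₁)))
        seen-from-x₁ _ (inj₂ y₂-nearer-x₁) = far-edges-differ y₁~x₁ y₂~x₂ far (trans same′ (col-flip x₂~y₂ y₂~x₂))
          where
            far : dist y₁ x₂ ≡ suc (suc (dist x₁ y₂))
            far = trans (dist-sym y₁ x₂) (trans x₁-nearer (cong suc (trans (dist-sym x₂ x₁) y₂-nearer-x₁)))

        seen-from-y₂ : Nearer y₂ x₁ y₁ ⊎ Nearer y₂ y₁ x₁ → x₁ ≡ x₂ × y₁ ≡ y₂
        seen-from-y₂ (inj₁ x₁-nearer-y₂) = ⊥-elim (seen-from-x₁ x₁-nearer-y₂ (black-sides x₂~y₂ b₂ x₁~y₁ b₁))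
        seen-from-y₂ (inj₂ y₁-nearer-y₂) = parallel-edges x₁~y₁ x₂~y₂ x₁-nearer y₁-nearer-y₂

    sameColour⇒sameEdge : ∀ {x₁ y₁ x₂ y₂} (x₁~y₁ : T (adj x₁ y₁)) → T (eb x₁ y₁) →
                          (x₂~y₂ : T (adj x₂ y₂)) → T (eb x₂ y₂) →
                          col x₁ y₁ x₁~y₁ ≡ col x₂ y₂ x₂~y₂ → SameEdge x₁ y₁ x₂ y₂
    sameColour⇒sameEdge {x₁} {y₁} {x₂} {y₂} x₁~y₁ b₁ x₂~y₂ b₂ same =
      seen-from-x₂ (black-sides x₁~y₁ b₁ x₂~y₂ b₂)
      where
        seen-from-x₂ : Nearer x₂ x₁ y₁ ⊎ Nearer x₂ y₁ x₁ → SameEdge x₁ y₁ x₂ y₂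
        seen-from-x₂ (inj₁ x₁-nearer) = inj₁ (oriented x₁~y₁ b₁ x₂~y₂ b₂ x₁-nearer same)
        seen-from-x₂ (inj₂ y₁-nearer) =
          swap (oriented y₁~x₁ (eb-flip x₁~y₁ b₁) x₂~y₂ b₂ y₁-nearer (trans (col-flip y₁~x₁ x₁~y₁) same))
          where
            y₁~x₁ : T (adj y₁ x₁)
            y₁~x₁ = adj-sym x₁ y₁ x₁~y₁
            swap : y₁ ≡ x₂ × x₁ ≡ y₂ → SameEdge x₁ y₁ x₂ y₂
            swap (y₁≡x₂ , x₁≡y₂) = inj₂ (x₁≡y₂ , y₁≡x₂)

    blackPair : Fin n × Fin n → Bool
    blackPair uv = (toℕ (proj₁ uv) <ᵇ toℕ (proj₂ uv)) ∧ adj (proj₁ uv) (proj₂ uv) ∧ eb (proj₁ uv) (proj₂ uv)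

    blackPair-sound : ∀ u v → T (blackPair (u , v)) → toℕ u < toℕ v × T (adj u v) × T (eb u v)
    blackPair-sound u v t with Equivalence.to T-∧ t
    ... | u<ᵇv , rest = <ᵇ⇒< (toℕ u) (toℕ v) u<ᵇv , Equivalence.to T-∧ rest

    pairColour : ∀ uv → T (blackPair uv) → Fin k
    pairColour (u , v) t = col u v (proj₁ (proj₂ (blackPair-sound u v t)))

    pairColour-injective : ∀ {uv uv′} t t′ → pairColour uv t ≡ pairColour uv′ t′ → uv ≡ uv′
    pairColour-injective {u , v} {u′ , v′} t t′ same =
      ordered-pair (proj₁ uv) (proj₁ uv′)
        (sameColour⇒sameEdge (proj₁ (proj₂ uv)) (proj₂ (proj₂ uv)) (proj₁ (proj₂ uv′)) (proj₂ (proj₂ uv′)) same)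
      where
        uv : toℕ u < toℕ v × T (adj u v) × T (eb u v)
        uv = blackPair-sound u v t
        uv′ : toℕ u′ < toℕ v′ × T (adj u′ v′) × T (eb u′ v′)
        uv′ = blackPair-sound u′ v′ t′

corollary1 : (G : Graph) → NonEmpty G → Connected G → OddCactus G →
             (P : BWPartition G) → (k : ℕ) → IsSRC G k → countEB G P ≤ k
corollary1 G _ conn (cactus , odd) P k ((c , rainbow) , _) =
  count≤ blackPair _ (allPairs-unique n) pairColour pairColour-injective
  where
    open Graph G using (n)
    open BlackEdges G conn odd cactus P
    open Colours c rainbow
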